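{- For every integer $n\ge3$, there is a connected signed graph with $6n$ vertices, maximum degree $5$, and chromatic number $3$, such that its largest eigenvalue appears with multiplicity $n$.
   Context: A signed graph is a finite simple graph each of whose edges is labeled positive or negative; its eigenvalues are those of its signed adjacency matrix (entry $1$ for a positive edge, $-1$ for a negative edge, $0$ otherwise). Degree and connectivity refer to the underlying graph. A valid $t$-coloring of a signed graph is a vertex coloring with $t$ colors such that the endpoints of every negative edge get distinct colors and the endpoints of every positive edge get the same color; the chromatic number is the least $t$ for which a valid $t$-coloring exists. -}

module Defs where

open import Level using (0ℓ)
open import Data.Nat using (ℕ; zero; suc; _<_; _≤_)
open import Data.Fin using (Fin)
import Data.Fin as F
open import Data.List using (List; length; filter)
open import Data.List.Base using (allFin)
open import Data.Product using (Σ; ∃; _×_; _,_)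
open import Relation.Nullary using (¬_; Dec; yes; no)
open import Relation.Binary.PropositionalEquality using (_≡_; _≢_)
open import Relation.Binary.Structures using (IsTotalOrder)
open import Algebra.Bundles using (CommutativeRing)

data Label : Set where
  none pos neg : Label

isEdge? : (l : Label) → Dec (l ≢ none)
isEdge? none = no (λ f → f _≡_.refl)
isEdge? pos  = yes (λ ())
isEdge? neg  = yes (λ ())

record SignedGraph (m : ℕ) : Set where
  field
    edge     : Fin m → Fin m → Label
    symmetric : ∀ i j → edge i j ≡ edge j i
    loopless  : ∀ i → edge i i ≡ none
open SignedGraph public

Adj : ∀ {m} → SignedGraph m → Fin m → Fin m → Set
Adj G i j = edge G i j ≢ none

degree : ∀ {m} → SignedGraph m → Fin m → ℕ
degree G i = length (filter (λ j → isEdge? (edge G i j)) (allFin _))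

MaxDegree : ∀ {m} → SignedGraph m → ℕ → Set
MaxDegree G d = (∀ i → degree G i ≤ d) × ∃ (λ i → degree G i ≡ d)

data Reach {m} (G : SignedGraph m) (i : Fin m) : Fin m → Set where
  here : Reach G i i
  step : ∀ {j k} → Reach G i j → Adj G j k → Reach G i k

Connected : ∀ {m} → SignedGraph m → Set
Connected G = ∀ i j → Reach G i j

ValidColoring : ∀ {m} → SignedGraph m → (t : ℕ) → (Fin _ → Fin t) → Set
ValidColoring G t c =
  (∀ i j → edge G i j ≡ neg → c i ≢ c j) ×
  (∀ i j → edge G i j ≡ pos → c i ≡ c j)

Colorable : ∀ {m} → SignedGraph m → ℕ → Set
Colorable {m} G t = Σ (Fin m → Fin t) (ValidColoring G t)

ChromaticNumber : ∀ {m} → SignedGraph m → ℕ → Set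
ChromaticNumber G k = Colorable G k × (∀ t → t < k → ¬ Colorable G t)

record Reals : Set₁ where
  field
    commRing : CommutativeRing 0ℓ 0ℓ
  open CommutativeRing commRing public
  field
    _≤ᵣ_          : Carrier → Carrier → Set
    ≤-isTotalOrder : IsTotalOrder _≈_ _≤ᵣ_
    0≉1           : ¬ (0# ≈ 1#)
    inverse       : ∀ x → ¬ (x ≈ 0#) → ∃ λ y → x * y ≈ 1#
    +-monoˡ-≤     : ∀ {x y} z → x ≤ᵣ y → (x + z) ≤ᵣ (y + z)
    *-nonneg      : ∀ {x y} → 0# ≤ᵣ x → 0# ≤ᵣ y → 0# ≤ᵣ (x * y)
    sup : (P : Carrier → Set) → ∃ P → ∃ (λ b → ∀ x → P x → x ≤ᵣ b) →
          ∃ λ s → (∀ x → P x → x ≤ᵣ s) ×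
                  (∀ b → (∀ x → P x → x ≤ᵣ b) → s ≤ᵣ b)

module Spectral (ℝ : Reals) where
  open Reals ℝ

  sumᵣ : ∀ {m} → (Fin m → Carrier) → Carrier
  sumᵣ {zero}  f = 0#
  sumᵣ {suc m} f = f F.zero + sumᵣ (λ i → f (F.suc i))

  entry : Label → Carrier
  entry none = 0#
  entry pos  = 1#
  entry neg  = - 1#

  adjMatrix : ∀ {m} → SignedGraph m → Fin m → Fin m → Carrier
  adjMatrix G i j = entry (edge G i j)

  apply : ∀ {m} → SignedGraph m → (Fin m → Carrier) → Fin m → Carrier
  apply G x i = sumᵣ (λ j → adjMatrix G i j * x j)

  InEigenspace : ∀ {m} → SignedGraph m → Carrier → (Fin m → Carrier) → Set
  InEigenspace G λ₀ x = ∀ i → apply G x i ≈ λ₀ * x i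

  Nonzero : ∀ {m} → (Fin m → Carrier) → Set
  Nonzero x = ∃ λ i → ¬ (x i ≈ 0#)

  IsEigenvalue : ∀ {m} → SignedGraph m → Carrier → Set
  IsEigenvalue G λ₀ = ∃ λ x → Nonzero x × InEigenspace G λ₀ x

  LinearlyIndependent : ∀ {m} {k} → (Fin k → Fin m → Carrier) → Set
  LinearlyIndependent {k = k} v =
    ∀ (c : Fin k → Carrier) → (∀ i → sumᵣ (λ l → c l * v l i) ≈ 0#) → ∀ l → c l ≈ 0#

  EigenspaceDim : ∀ {m} → SignedGraph m → Carrier → ℕ → Set
  EigenspaceDim G λ₀ n =
    (∃ λ (v : Fin n → _) → (∀ l → InEigenspace G λ₀ (v l)) × LinearlyIndependent v) ×
    (∀ (v : Fin (suc n) → _) → (∀ l → InEigenspace G λ₀ (v l)) → ¬ LinearlyIndependent v)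

  LargestEigenvalueMultiplicity : ∀ {m} → SignedGraph m → ℕ → Set
  LargestEigenvalueMultiplicity G n =
    ∃ λ λ₀ → IsEigenvalue G λ₀ × (∀ μ → IsEigenvalue G μ → μ ≤ᵣ λ₀) × EigenspaceDim G λ₀ n

LargestEigenvalueMultiplicity : Reals → ∀ {m} → SignedGraph m → ℕ → Set
LargestEigenvalueMultiplicity ℝ = Spectral.LargestEigenvalueMultiplicity ℝ

-- Take n copies of the signed graph on six vertices A, B, C, D, E, L with negative edges
-- A–C, A–D, B–C, B–D, C–D, C–E, C–L, E–L, and join L of copy p to D of copy p + 1 (mod n)
-- by a positive edge.  Colouring A, B, E / C / D, L with three colours is valid, and the
-- negative triangle C E L needs three.  For the forms (on copy p)
--   φ₀ = A + B + C + D,  φ₁ = A − B,  φ₂ = C + E + L,  φ₃ = D − L of copy p − 1,  φ₄ = E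
-- the signed adjacency matrix M satisfies M = 2I − ΦᵀΦ, i.e. 2|x|² − ⟨x, Mx⟩ = Σ φⱼ(x)².  So every
-- eigenvalue is at most 2 and the 2-eigenspace is ker Φ, which is parametrised by the
-- values on the n vertices L.  In a constructive complete ordered field, x² = 0 only gives
-- ¬¬ (x = 0); that is enough because the upper bound on the dimension is a negation.
module Submission where

open import Defs
open import Algebra.Bundles using (CommutativeRing; CommutativeMonoid)
open import Data.Bool using (true; false; if_then_else_)
open import Data.Fin
  using (Fin; zero; suc; fromℕ; inject₁; punchIn; _↑ˡ_; _↑ʳ_; combine; remQuot)
open import Data.Fin.Induction using (<-weakInduction)
open import Data.Fin.Patterns using (0F; 1F; 2F; 3F; 4F; 5F)
open import Data.Fin.Properties
  using (all?; punchInᵢ≢i; remQuot-combine; combine-remQuot; pigeonhole; <⇒≢)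
  renaming (_≟_ to _≟ᶠ_)
open import Data.Fin.Relation.Unary.Top using (View; view; ‵fromℕ; ‵inj₁; view-fromℕ; view-inject₁)
open import Data.Integer as ℤ using (0ℤ; 1ℤ; -1ℤ)
import Data.Integer.Properties as ℤₚ
open import Data.List using (length; filter; tabulate)
open import Data.Maybe as Maybe using (Maybe)
open import Data.Nat as ℕ using (ℕ; zero; suc; _≤_; _<_; _≤?_)
open import Data.Nat.Properties using (+-0-commutativeMonoid)
open import Data.Product using (Σ; ∃; _×_; _,_; proj₁; proj₂; uncurry)
open import Data.Sum using (_⊎_; inj₁; inj₂)
open import Data.Unit using (⊤)
open import Data.Vec using (Vec; []; _∷_; lookup)
import Data.Vec.Functional as Vector
open import Data.Vec.Functional.Properties using (insertAt-lookup; insertAt-punchIn)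
open import Function using (_∘_; id)
open import Relation.Binary.Definitions using (DecidableEquality)
open import Relation.Binary.PropositionalEquality as ≡ using (_≡_; _≢_)
open import Relation.Binary.Structures using (IsTotalOrder)
open import Relation.Nullary using (¬_; Dec; yes; no; does; contradiction)
open import Relation.Nullary.Decidable
  using (dec⇒maybe; ¬¬-excluded-middle; from-yes; ¬?; _→-dec_; _×-dec_)
open import Relation.Unary using (Pred; Decidable)

¬¬-∀ : ∀ {p n} {P : Fin n → Set p} → (∀ i → ¬ ¬ P i) → ¬ ¬ (∀ i → P i)
¬¬-∀ {n = zero}  ¬¬P ¬∀P = ¬∀P λ ()
¬¬-∀ {n = suc n} ¬¬P ¬∀P = ¬¬P zero λ P₀ →
  ¬¬-∀ (¬¬P ∘ suc) λ P₊ → ¬∀P λ { zero → P₀ ; (suc i) → P₊ i }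

¬¬-∀⊎∃¬ : ∀ {p n} (P : Fin n → Set p) → ¬ ¬ ((∀ i → P i) ⊎ ∃ λ i → ¬ P i)
¬¬-∀⊎∃¬ P ¬∀⊎∃¬ = ¬¬-excluded-middle λ where
  (yes ∃¬) → ¬∀⊎∃¬ (inj₂ ∃¬)
  (no ¬∃¬) → ¬¬-∀ (λ i ¬Pi → ¬∃¬ (i , ¬Pi)) (¬∀⊎∃¬ ∘ inj₁)

module IntegerCoefficients {c ℓ} (R : CommutativeRing c ℓ) where
  open CommutativeRing R
  open ℤ using (+_; -[1+_]; _⊖_)
  open import Algebra.Properties.Ring ring
    using (-0#≈0#; -‿involutive; -‿+-comm; -‿distribˡ-*; -‿distribʳ-*; xyx⁻¹≈y)
  -- The optimised multiplication makes ⟦ 1ℤ ⟧ and ⟦ -1ℤ ⟧ reduce to 1# and - 1#, so that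
  -- goals written with 1# and - 1# are instances of solver equations.
  open import Algebra.Properties.Monoid.Mult.TCOptimised +-monoid using (×-homo-+; 1+×) renaming (_×_ to _×′_)
  open import Algebra.Properties.Semiring.Mult.TCOptimised semiring using (×1-homo-*)
  open import Algebra.Solver.Ring.AlmostCommutativeRing
    using (fromCommutativeRing; _-Raw-AlmostCommutative⟶_)
  open import Relation.Binary.Reasoning.Setoid setoid

  ⟦_⟧ : ℤ.ℤ → Carrier
  ⟦ + n ⟧      = n ×′ 1#
  ⟦ -[1+ n ] ⟧ = - (suc n ×′ 1#)

  ⊖-homo : ∀ m n → ⟦ m ⊖ n ⟧ ≈ m ×′ 1# - n ×′ 1#
  ⊖-homo m       zero    = sym (trans (+-congˡ -0#≈0#) (+-identityʳ _))
  ⊖-homo zero    (suc n) = sym (+-identityˡ _)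
  ⊖-homo (suc m) (suc n) = begin
    ⟦ suc m ⊖ suc n ⟧                    ≡⟨ ≡.cong ⟦_⟧ (ℤₚ.[1+m]⊖[1+n]≡m⊖n m n) ⟩
    ⟦ m ⊖ n ⟧                            ≈⟨ ⊖-homo m n ⟩
    m ×′ 1# - n ×′ 1#                      ≈⟨ xyx⁻¹≈y 1# _ ⟨
    1# + (m ×′ 1# - n ×′ 1#) - 1#          ≈⟨ +-assoc _ _ _ ⟩
    1# + ((m ×′ 1# - n ×′ 1#) - 1#)        ≈⟨ +-congˡ (+-assoc _ _ _) ⟩
    1# + (m ×′ 1# + (- (n ×′ 1#) - 1#))    ≈⟨ +-assoc _ _ _ ⟨
    (1# + m ×′ 1#) + (- (n ×′ 1#) - 1#)    ≈⟨ +-cong (1+× m 1#) (trans (sym (-‿+-comm _ _)) (+-comm _ _)) ⟨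
    suc m ×′ 1# - (1# + n ×′ 1#)           ≈⟨ +-congˡ (-‿cong (1+× n 1#)) ⟨
    suc m ×′ 1# - suc n ×′ 1#              ∎

  +-homo : ∀ i j → ⟦ i ℤ.+ j ⟧ ≈ ⟦ i ⟧ + ⟦ j ⟧
  +-homo (+ m)    (+ n)    = ×-homo-+ 1# m n
  +-homo (+ m)    -[1+ n ] = ⊖-homo m (suc n)
  +-homo -[1+ m ] (+ n)    = trans (⊖-homo n (suc m)) (+-comm _ _)
  +-homo -[1+ m ] -[1+ n ] = begin
    ⟦ -[1+ m ] ℤ.+ -[1+ n ] ⟧           ≡⟨ ≡.cong ⟦_⟧ (ℤₚ.neg-distrib-+ (+ suc m) (+ suc n)) ⟨
    - ((suc m ℕ.+ suc n) ×′ 1#)          ≈⟨ -‿cong (×-homo-+ 1# (suc m) (suc n)) ⟩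
    - (suc m ×′ 1# + suc n ×′ 1#)         ≈⟨ -‿+-comm _ _ ⟨
    ⟦ -[1+ m ] ⟧ + ⟦ -[1+ n ] ⟧         ∎

  -‿homo : ∀ i → ⟦ ℤ.- i ⟧ ≈ - ⟦ i ⟧
  -‿homo (+ zero)  = sym -0#≈0#
  -‿homo (+ suc n) = refl
  -‿homo -[1+ n ]  = sym (-‿involutive _)

  *-homo⁺ : ∀ m j → ⟦ + m ℤ.* j ⟧ ≈ ⟦ + m ⟧ * ⟦ j ⟧
  *-homo⁺ m (+ n)    = trans (reflexive (≡.cong ⟦_⟧ (≡.sym (ℤₚ.pos-* m n)))) (×1-homo-* m n)
  *-homo⁺ m -[1+ n ] = begin
    ⟦ + m ℤ.* ℤ.- (+ suc n) ⟧          ≡⟨ ≡.cong ⟦_⟧ (ℤₚ.neg-distribʳ-* (+ m) (+ suc n)) ⟨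
    ⟦ ℤ.- (+ m ℤ.* + suc n) ⟧          ≈⟨ -‿homo (+ m ℤ.* + suc n) ⟩
    - ⟦ + m ℤ.* + suc n ⟧              ≈⟨ -‿cong (*-homo⁺ m (+ suc n)) ⟩
    - (⟦ + m ⟧ * ⟦ + suc n ⟧)          ≈⟨ -‿distribʳ-* _ _ ⟩
    ⟦ + m ⟧ * ⟦ -[1+ n ] ⟧             ∎

  *-homo : ∀ i j → ⟦ i ℤ.* j ⟧ ≈ ⟦ i ⟧ * ⟦ j ⟧
  *-homo (+ m)    j = *-homo⁺ m j
  *-homo -[1+ m ] j = begin
    ⟦ ℤ.- (+ suc m) ℤ.* j ⟧            ≡⟨ ≡.cong ⟦_⟧ (ℤₚ.neg-distribˡ-* (+ suc m) j) ⟨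
    ⟦ ℤ.- (+ suc m ℤ.* j) ⟧            ≈⟨ -‿homo (+ suc m ℤ.* j) ⟩
    - ⟦ + suc m ℤ.* j ⟧                ≈⟨ -‿cong (*-homo⁺ (suc m) j) ⟩
    - (⟦ + suc m ⟧ * ⟦ j ⟧)            ≈⟨ -‿distribˡ-* _ _ ⟩
    ⟦ -[1+ m ] ⟧ * ⟦ j ⟧               ∎

  ℤ⟶R : ℤ.+-*-rawRing -Raw-AlmostCommutative⟶ fromCommutativeRing R
  ℤ⟶R = record
    { ⟦_⟧ = ⟦_⟧ ; +-homo = +-homo ; *-homo = *-homo ; -‿homo = -‿homo
    ; 0-homo = refl ; 1-homo = refl }

  ⟦⟧-≟ : ∀ i j → Maybe (⟦ i ⟧ ≈ ⟦ j ⟧)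
  ⟦⟧-≟ i j = Maybe.map (reflexive ∘ ≡.cong ⟦_⟧) (dec⇒maybe (i ℤ.≟ j))

  open import Algebra.Solver.Ring ℤ.+-*-rawRing (fromCommutativeRing R) ℤ⟶R ⟦⟧-≟ public
    using (solve; _:=_; _:+_; _:*_; _:-_; :-_; con)

data Shift : Set where
  stay forward backward : Shift

reverse : Shift → Shift
reverse stay     = stay
reverse forward  = backward
reverse backward = forward

_≟ˢ_ : DecidableEquality Shift
stay     ≟ˢ stay     = yes ≡.refl
stay     ≟ˢ forward  = no λ ()
stay     ≟ˢ backward = no λ ()
forward  ≟ˢ stay     = no λ ()
forward  ≟ˢ forward  = yes ≡.refl
forward  ≟ˢ backward = no λ ()
backward ≟ˢ stay     = no λ ()
backward ≟ˢ forward  = no λ ()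
backward ≟ˢ backward = yes ≡.refl

module CyclicOrder (m : ℕ) where

  prev : Fin (suc m) → Fin (suc m)
  prev zero    = fromℕ m
  prev (suc i) = inject₁ i

  next : Fin (suc m) → Fin (suc m)
  next i = nextᵛ (view i)
    where
    nextᵛ : ∀ {i : Fin (suc m)} → View i → Fin (suc m)
    nextᵛ ‵fromℕ            = zero
    nextᵛ (‵inj₁ {i = j} _) = suc j

  next-fromℕ : next (fromℕ m) ≡ zero
  next-fromℕ rewrite view-fromℕ m = ≡.refl

  next-inject₁ : ∀ i → next (inject₁ i) ≡ suc i
  next-inject₁ i rewrite view-inject₁ i = ≡.refl

  next-prev : ∀ i → next (prev i) ≡ i
  next-prev zero    = next-fromℕ
  next-prev (suc i) = next-inject₁ i

  prev-next : ∀ i → prev (next i) ≡ i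
  prev-next i with view i
  ... | ‵fromℕ  = ≡.refl
  ... | ‵inj₁ _ = ≡.refl

  move : Shift → Fin (suc m) → Fin (suc m)
  move stay     = id
  move forward  = next
  move backward = prev

  move-reverse : ∀ s {p q} → q ≡ move s p → p ≡ move (reverse s) q
  move-reverse stay     q≡p    = ≡.sym q≡p
  move-reverse forward  q≡next = ≡.trans (≡.sym (prev-next _)) (≡.cong prev (≡.sym q≡next))
  move-reverse backward q≡prev = ≡.trans (≡.sym (next-prev _)) (≡.cong next (≡.sym q≡prev))

module FinSum {c ℓ} (M : CommutativeMonoid c ℓ) where
  open CommutativeMonoid M
    renaming (_∙_ to _+_; ε to 0#; ∙-congˡ to +-congˡ; assoc to +-assoc;
              identityˡ to +-identityˡ; identityʳ to +-identityʳ; comm to +-comm)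
  open import Algebra.Properties.CommutativeMonoid.Sum M public
  open import Relation.Binary.Reasoning.Setoid setoid

  sum-↑ : ∀ m {k} (f : Fin (m ℕ.+ k) → Carrier) →
          sum f ≈ sum (f ∘ (_↑ˡ k)) + sum (f ∘ (m ↑ʳ_))
  sum-↑ zero    f = sym (+-identityˡ _)
  sum-↑ (suc m) f = trans (+-congˡ (sum-↑ m (f ∘ suc))) (sym (+-assoc _ _ _))

  sum-combine : ∀ m {n} (f : Fin (m ℕ.* n) → Carrier) → sum f ≈ ∑[ i < m ] ∑[ j < n ] f (combine i j)
  sum-combine zero        f = refl
  sum-combine (suc m) {n} f = trans (sum-↑ n f) (+-congˡ (sum-combine m (f ∘ (n ↑ʳ_))))

  sum-δ : ∀ {n} (i : Fin n) (f : Fin n → Carrier) → (∀ j → j ≢ i → f j ≈ 0#) → sum f ≈ f i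
  sum-δ {suc n} i f off-i = begin
    sum f                            ≈⟨ sum-remove {i = i} f ⟩
    f i + sum (f ∘ punchIn i)        ≈⟨ +-congˡ (sum-cong-≋ {n} (λ j → off-i _ (punchInᵢ≢i i j))) ⟩
    f i + sum {n} (λ _ → 0#)         ≈⟨ +-congˡ (sum-replicate-zero n) ⟩
    f i + 0#                         ≈⟨ +-identityʳ _ ⟩
    f i                              ∎

  sum-rotate : ∀ m (h : Fin (suc m) → Carrier) → sum (h ∘ CyclicOrder.next m) ≈ sum h
  sum-rotate m h = begin
    sum (h ∘ next)                                 ≈⟨ sum-init-last (h ∘ next) ⟩
    sum (h ∘ next ∘ inject₁) + h (next (fromℕ m))  ≡⟨ ≡.cong₂ _+_ (sum-cong-≗ (≡.cong h ∘ next-inject₁))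
                                                                  (≡.cong h next-fromℕ) ⟩
    sum (h ∘ suc) + h zero                         ≈⟨ +-comm _ _ ⟩
    sum h                                          ∎
    where open CyclicOrder m

module ℕΣ = FinSum +-0-commutativeMonoid

length-filter-tabulate : ∀ {a p} {A : Set a} {P : Pred A p} (P? : Decidable P) {m} (f : Fin m → A) →
  length (filter P? (tabulate f)) ≡ ℕΣ.sum (λ i → if does (P? (f i)) then 1 else 0)
length-filter-tabulate P? {zero}  f = ≡.refl
length-filter-tabulate P? {suc m} f with does (P? (f zero))
... | true  = ≡.cong suc (length-filter-tabulate P? (f ∘ suc))
... | false = length-filter-tabulate P? (f ∘ suc)

module OrderedField (ℝ : Reals) where
  open Reals ℝ hiding (zero)
  open Spectral ℝ
  open IntegerCoefficients commRing public using (solve; _:=_; _:+_; _:*_; _:-_; :-_; con)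
  open FinSum +-commutativeMonoid public
  open import Algebra.Properties.Semiring.Sum semiring public using (*-distribˡ-sum)
  open import Algebra.Properties.Ring ring public using (+-cancelˡ; +-cancelʳ; -0#≈0#)
  module ≤ = IsTotalOrder ≤-isTotalOrder
  open import Relation.Binary.Reasoning.Setoid setoid

  sumᵣ≡sum : ∀ {m} (f : Fin m → Carrier) → sumᵣ f ≡ sum f
  sumᵣ≡sum {zero}  f = ≡.refl
  sumᵣ≡sum {suc m} f = ≡.cong (f zero +_) (sumᵣ≡sum (f ∘ suc))

  -‿nonNeg : ∀ {x} → x ≤ᵣ 0# → 0# ≤ᵣ (- x)
  -‿nonNeg {x} x≤0 = ≤.≲-respˡ-≈ (-‿inverseʳ x) (≤.≲-respʳ-≈ (+-identityˡ (- x)) (+-monoˡ-≤ (- x) x≤0))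

  square-nonNeg : ∀ x → 0# ≤ᵣ (x * x)
  square-nonNeg x with ≤.total 0# x
  ... | inj₁ 0≤x = *-nonneg 0≤x 0≤x
  ... | inj₂ x≤0 = ≤.≲-respʳ-≈ (solve 1 (λ x → (:- x) :* (:- x) := x :* x) refl x)
                                (*-nonneg (-‿nonNeg x≤0) (-‿nonNeg x≤0))

  x≤x+y : ∀ x {y} → 0# ≤ᵣ y → x ≤ᵣ (x + y)
  x≤x+y x {y} 0≤y = ≤.≲-respˡ-≈ (+-identityˡ x) (≤.≲-respʳ-≈ (+-comm y x) (+-monoˡ-≤ x 0≤y))

  +-nonNeg : ∀ {x y} → 0# ≤ᵣ x → 0# ≤ᵣ y → 0# ≤ᵣ (x + y)
  +-nonNeg {x} 0≤x 0≤y = ≤.trans 0≤x (x≤x+y x 0≤y)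

  nonNeg+nonNeg≈0⇒≈0 : ∀ {x y} → 0# ≤ᵣ x → 0# ≤ᵣ y → x + y ≈ 0# → x ≈ 0#
  nonNeg+nonNeg≈0⇒≈0 {x} 0≤x 0≤y x+y≈0 = ≤.antisym (≤.≲-respʳ-≈ x+y≈0 (x≤x+y x 0≤y)) 0≤x

  sum-nonNeg : ∀ {m} (f : Fin m → Carrier) → (∀ i → 0# ≤ᵣ f i) → 0# ≤ᵣ (sum f)
  sum-nonNeg {zero}  f 0≤f = ≤.refl
  sum-nonNeg {suc m} f 0≤f = +-nonNeg (0≤f zero) (sum-nonNeg (f ∘ suc) (0≤f ∘ suc))

  sum-nonNeg≈0⇒≈0 : ∀ {m} (f : Fin m → Carrier) → (∀ i → 0# ≤ᵣ f i) → sum f ≈ 0# → ∀ i → f i ≈ 0#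
  sum-nonNeg≈0⇒≈0 {suc m} f 0≤f Σf≈0 i = nonNeg+nonNeg≈0⇒≈0 (0≤f i)
    (sum-nonNeg (f ∘ punchIn i) (0≤f ∘ punchIn i)) (trans (sym (sum-remove {i = i} f)) Σf≈0)

  *-cancelʳ-≈0 : ∀ {x y} → ¬ y ≈ 0# → x * y ≈ 0# → x ≈ 0#
  *-cancelʳ-≈0 {x} {y} y≉0 xy≈0 with y⁻¹ , yy⁻¹≈1 ← inverse y y≉0 = begin
    x                ≈⟨ *-identityʳ x ⟨
    x * 1#           ≈⟨ *-congˡ yy⁻¹≈1 ⟨
    x * (y * y⁻¹)    ≈⟨ *-assoc x y y⁻¹ ⟨
    (x * y) * y⁻¹    ≈⟨ *-congʳ xy≈0 ⟩
    0# * y⁻¹         ≈⟨ zeroˡ y⁻¹ ⟩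
    0#               ∎

  square≈0⇒¬¬≈0 : ∀ {x} → x * x ≈ 0# → ¬ ¬ x ≈ 0#
  square≈0⇒¬¬≈0 xx≈0 x≉0 = x≉0 (*-cancelʳ-≈0 x≉0 xx≈0)

  sum-squares≈0⇒¬¬≈0 : ∀ {m} (x : Fin m → Carrier) → sum (λ i → x i * x i) ≈ 0# → ∀ i → ¬ ¬ x i ≈ 0#
  sum-squares≈0⇒¬¬≈0 x Σx²≈0 i = square≈0⇒¬¬≈0 (sum-nonNeg≈0⇒≈0 _ (square-nonNeg ∘ x) Σx²≈0 i)

  two : Carrier
  two = 1# + 1#

  two≉0 : ¬ two ≈ 0#
  two≉0 two≈0 = 0≉1 (≤.antisym 0≤1 (≤.≲-respʳ-≈ two≈0 (x≤x+y 1# 0≤1)))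
    where
    0≤1 : 0# ≤ᵣ 1#
    0≤1 = ≤.≲-respʳ-≈ (*-identityˡ 1#) (square-nonNeg 1#)

  half : Carrier
  half = proj₁ (inverse two two≉0)

  two*half≈1 : two * half ≈ 1#
  two*half≈1 = proj₂ (inverse two two≉0)

  x≈x*[two*half] : ∀ x → x ≈ x * (two * half)
  x≈x*[two*half] x = sym (trans (*-congˡ two*half≈1) (*-identityʳ x))

  0+0≈0 : ∀ {x y} → x ≈ 0# → y ≈ 0# → x + y ≈ 0#
  0+0≈0 x≈0 y≈0 = trans (+-cong x≈0 y≈0) (+-identityʳ 0#)

  0-0≈0 : ∀ {x y} → x ≈ 0# → y ≈ 0# → x - y ≈ 0#
  0-0≈0 x≈0 y≈0 = trans (+-cong x≈0 (trans (-‿cong y≈0) -0#≈0#)) (+-identityʳ 0#)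

  ≈+≈0⇒≈ : ∀ {x y z} → x ≈ y + z → z ≈ 0# → x ≈ y
  ≈+≈0⇒≈ x≈y+z z≈0 = trans x≈y+z (trans (+-congˡ z≈0) (+-identityʳ _))

module LinearAlgebra (ℝ : Reals) where
  open Reals ℝ hiding (zero)
  open Spectral ℝ
  open OrderedField ℝ
  open import Relation.Binary.Reasoning.Setoid setoid

  dropFirst : ∀ {m k} → (Fin (suc k) → Fin (suc m) → Carrier) → Fin k → Fin m → Carrier
  dropFirst v l i = v (suc l) (suc i)

  dropZeroColumn : ∀ {m k} (v : Fin (suc k) → Fin (suc m) → Carrier) → (∀ l → v l zero ≈ 0#) →
                   LinearlyIndependent v → LinearlyIndependent (dropFirst v)
  dropZeroColumn {k = k} v column≈0 li c Σcv≈0 l = li (0# Vector.∷ c) Σ≈0 (suc l)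
    where
    Σ≈0 : ∀ i → sumᵣ (λ l → (0# Vector.∷ c) l * v l i) ≈ 0#
    Σ≈0 zero    = begin
      0# * v zero zero + sumᵣ (λ l → c l * v (suc l) zero)  ≈⟨ +-cong (zeroˡ _) (reflexive (sumᵣ≡sum {k} _)) ⟩
      0# + sum (λ l → c l * v (suc l) zero)                ≈⟨ +-identityˡ _ ⟩
      sum (λ l → c l * v (suc l) zero)
        ≈⟨ sum-cong-≋ (λ l → trans (*-congˡ (column≈0 (suc l))) (zeroʳ _)) ⟩
      sum {k} (λ _ → 0#)                                   ≈⟨ sum-replicate-zero k ⟩
      0#                                                   ∎
    Σ≈0 (suc i) = trans (+-cong (zeroˡ _) (Σcv≈0 i)) (+-identityˡ _)

  eliminate : ∀ {m k} → (Fin (suc k) → Fin (suc m) → Carrier) → Fin (suc k) → Carrier → Fin k → Fin m → Carrier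
  eliminate v q d l i = v (punchIn q l) (suc i) - (v (punchIn q l) zero * d) * v q (suc i)

  eliminatePivot : ∀ {m k} (v : Fin (suc k) → Fin (suc m) → Carrier) (q : Fin (suc k)) {d} →
                   v q zero * d ≈ 1# → LinearlyIndependent v → LinearlyIndependent (eliminate v q d)
  eliminatePivot {k = k} v q {d} pivot li c Σcw≈0 l =
    trans (reflexive (≡.sym (insertAt-punchIn c q a l))) (li c′ Σc′v≈0 (punchIn q l))
    where
    s : Carrier
    s = sum (λ l → c l * v (punchIn q l) zero)
    a : Carrier
    a = - (s * d)
    c′ : Fin (suc k) → Carrier
    c′ = Vector.insertAt c q a
    expand : ∀ i → sumᵣ (λ l → c′ l * v l i) ≈ a * v q i + sum (λ l → c l * v (punchIn q l) i)
    expand i = begin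
      sumᵣ (λ l → c′ l * v l i)                               ≡⟨ sumᵣ≡sum (λ l → c′ l * v l i) ⟩
      sum (λ l → c′ l * v l i)                                ≈⟨ sum-remove {i = q} (λ l → c′ l * v l i) ⟩
      c′ q * v q i + sum (λ l → c′ (punchIn q l) * v (punchIn q l) i)
        ≈⟨ +-cong (*-congʳ (reflexive (insertAt-lookup c q a)))
                  (sum-cong-≋ λ l → *-congʳ (reflexive (insertAt-punchIn c q a l))) ⟩
      a * v q i + sum (λ l → c l * v (punchIn q l) i)        ∎
    Σc′v≈0 : ∀ i → sumᵣ (λ l → c′ l * v l i) ≈ 0#
    Σc′v≈0 zero    = trans (expand zero) (begin
      - (s * d) * v q zero + s       ≈⟨ solve 3 (λ s d p → :- (s :* d) :* p :+ s := :- (s :* (p :* d)) :+ s) refl s d (v q zero) ⟩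
      - (s * (v q zero * d)) + s     ≈⟨ +-congʳ (-‿cong (*-congˡ pivot)) ⟩
      - (s * 1#) + s                 ≈⟨ solve 1 (λ s → :- (s :* con 1ℤ) :+ s := con 0ℤ) refl s ⟩
      0#                             ∎)
    Σc′v≈0 (suc i) = trans (expand (suc i)) (begin
      - (s * d) * e + t
        ≈⟨ solve 4 (λ s d e t → :- (s :* d) :* e :+ t := t :+ :- (d :* e) :* s) refl s d e t ⟩
      t + - (d * e) * s                                  ≈⟨ +-congˡ (*-distribˡ-sum (- (d * e)) (λ l → c l * y l)) ⟩
      t + sum (λ l → - (d * e) * (c l * y l))
        ≈⟨ ∑-distrib-+ (λ l → c l * x l) (λ l → - (d * e) * (c l * y l)) ⟨
      sum (λ l → c l * x l + - (d * e) * (c l * y l))    ≈⟨ sum-cong-≋ (λ l → solve 5 (λ c x y d e →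
                                                              c :* x :+ :- (d :* e) :* (c :* y) := c :* (x :- (y :* d) :* e))
                                                              refl (c l) (x l) (y l) d e) ⟩
      sum (λ l → c l * (x l - (y l * d) * e))            ≡⟨ sumᵣ≡sum (λ l → c l * (x l - (y l * d) * e)) ⟨
      sumᵣ (λ l → c l * (x l - (y l * d) * e))           ≈⟨ Σcw≈0 i ⟩
      0#                                                 ∎)
      where
      e : Carrier
      e = v q (suc i)
      x y : Fin k → Carrier
      x l = v (punchIn q l) (suc i)
      y l = v (punchIn q l) zero
      t : Carrier
      t = sum (λ l → c l * x l)

  ¬LinearlyIndependent-suc : ∀ k (v : Fin (suc k) → Fin k → Carrier) → ¬ LinearlyIndependent v
  ¬LinearlyIndependent-suc zero    v li = 0≉1 (sym (li (λ _ → 1#) (λ ()) zero))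
  ¬LinearlyIndependent-suc (suc k) v li = ¬¬-∀⊎∃¬ (λ l → v l zero ≈ 0#) λ where
    (inj₁ column≈0)   → ¬LinearlyIndependent-suc k (dropFirst v) (dropZeroColumn v column≈0 li)
    (inj₂ (q , vq≉0)) → let d , pivot = inverse _ vq≉0 in
                        ¬LinearlyIndependent-suc k (eliminate v q d) (eliminatePivot v q pivot li)

  ⟨_,_⟩ : ∀ {k} → (Fin k → Carrier) → (Fin k → Carrier) → Carrier
  ⟨ x , y ⟩ = sum (λ i → x i * y i)

  ⟪_,_⟫ : ∀ {a b} → (Fin a → Fin b → Carrier) → (Fin a → Fin b → Carrier) → Carrier
  ⟪ y , z ⟫ = sum (λ j → ⟨ y j , z j ⟩)

  ⟪⟫-nonNeg : ∀ {a b} (y : Fin a → Fin b → Carrier) → 0# ≤ᵣ ⟪ y , y ⟫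
  ⟪⟫-nonNeg y = sum-nonNeg _ λ j → sum-nonNeg _ (square-nonNeg ∘ y j)

  ⟪⟫≈0⇒¬¬≈0 : ∀ {a b} (y : Fin a → Fin b → Carrier) → ⟪ y , y ⟫ ≈ 0# → ¬ ¬ (∀ j p → y j p ≈ 0#)
  ⟪⟫≈0⇒¬¬≈0 y ⟪y,y⟫≈0 = ¬¬-∀ λ j → ¬¬-∀ (sum-squares≈0⇒¬¬≈0 (y j)
    (sum-nonNeg≈0⇒≈0 _ (λ j → sum-nonNeg _ (square-nonNeg ∘ y j)) ⟪y,y⟫≈0 j))

  module SquaresDecomposition {m a b} (G : SignedGraph m) (c : Carrier)
    (Φ : (Fin m → Carrier) → Fin a → Fin b → Carrier) (Φᵀ : (Fin a → Fin b → Carrier) → Fin m → Carrier)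
    (adjoint : ∀ x y → ⟪ Φ x , y ⟫ ≈ ⟨ x , Φᵀ y ⟩)
    (apply+ΦᵀΦ≈c : ∀ x i → apply G x i + Φᵀ (Φ x) i ≈ c * x i)
    where

    rayleigh : ∀ {μ} x → InEigenspace G μ x → μ * ⟨ x , x ⟩ + ⟪ Φ x , Φ x ⟫ ≈ c * ⟨ x , x ⟩
    rayleigh {μ} x Ax≈μx = begin
      μ * ⟨ x , x ⟩ + ⟪ Φ x , Φ x ⟫                       ≈⟨ +-cong (*-distribˡ-sum {m} μ _) (adjoint x (Φ x)) ⟩
      sum (λ i → μ * (x i * x i)) + ⟨ x , Φᵀ (Φ x) ⟩      ≈⟨ ∑-distrib-+ {m} _ _ ⟨
      sum (λ i → μ * (x i * x i) + x i * Φᵀ (Φ x) i)      ≈⟨ sum-cong-≋ {m} pointwise ⟩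
      sum (λ i → c * (x i * x i))                         ≈⟨ *-distribˡ-sum {m} c _ ⟨
      c * ⟨ x , x ⟩                                       ∎
      where
      pointwise : ∀ i → μ * (x i * x i) + x i * Φᵀ (Φ x) i ≈ c * (x i * x i)
      pointwise i = begin
        μ * (x i * x i) + x i * Φᵀ (Φ x) i
          ≈⟨ solve 3 (λ μ a b → μ :* (a :* a) :+ a :* b := a :* (μ :* a :+ b)) refl μ (x i) _ ⟩
        x i * (μ * x i + Φᵀ (Φ x) i)           ≈⟨ *-congˡ (+-congʳ (Ax≈μx i)) ⟨
        x i * (apply G x i + Φᵀ (Φ x) i)       ≈⟨ *-congˡ (apply+ΦᵀΦ≈c x i) ⟩
        x i * (c * x i)                        ≈⟨ solve 2 (λ a c → a :* (c :* a) := c :* (a :* a)) refl (x i) c ⟩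
        c * (x i * x i)                        ∎

    eigenvalue≤ : ∀ μ → IsEigenvalue G μ → μ ≤ᵣ c
    eigenvalue≤ μ (x , (i₀ , xᵢ₀≉0) , Ax≈μx) with ≤.total μ c
    ... | inj₁ μ≤c = μ≤c
    ... | inj₂ c≤μ = ≤.reflexive μ≈c
      where
      S Q : Carrier
      S = ⟨ x , x ⟩
      Q = ⟪ Φ x , Φ x ⟫
      [μ-c]S+Q≈0 : (μ - c) * S + Q ≈ 0#
      [μ-c]S+Q≈0 = begin
        (μ - c) * S + Q          ≈⟨ solve 4 (λ μ c s q → (μ :- c) :* s :+ q := (μ :* s :+ q) :- c :* s) refl μ c S Q ⟩
        (μ * S + Q) - c * S      ≈⟨ +-congʳ (rayleigh x Ax≈μx) ⟩
        c * S - c * S            ≈⟨ -‿inverseʳ (c * S) ⟩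
        0#                       ∎
      0≤μ-c : 0# ≤ᵣ (μ - c)
      0≤μ-c = ≤.≲-respˡ-≈ (-‿inverseʳ c) (+-monoˡ-≤ (- c) c≤μ)
      S≉0 : ¬ S ≈ 0#
      S≉0 S≈0 = sum-squares≈0⇒¬¬≈0 x S≈0 i₀ xᵢ₀≉0
      [μ-c]S≈0 : (μ - c) * S ≈ 0#
      [μ-c]S≈0 = nonNeg+nonNeg≈0⇒≈0 (*-nonneg 0≤μ-c (sum-nonNeg _ (square-nonNeg ∘ x)))
                                    (⟪⟫-nonNeg (Φ x)) [μ-c]S+Q≈0
      μ≈c : μ ≈ c
      μ≈c = begin
        μ                 ≈⟨ solve 2 (λ μ c → μ := (μ :- c) :+ c) refl μ c ⟩
        (μ - c) + c       ≈⟨ +-congʳ (*-cancelʳ-≈0 S≉0 [μ-c]S≈0) ⟩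
        0# + c            ≈⟨ +-identityˡ c ⟩
        c                 ∎

    eigenvector⇒¬¬Φ≈0 : ∀ x → InEigenspace G c x → ¬ ¬ (∀ j p → Φ x j p ≈ 0#)
    eigenvector⇒¬¬Φ≈0 x Ax≈cx = ⟪⟫≈0⇒¬¬≈0 (Φ x)
      (+-cancelˡ (c * ⟨ x , x ⟩) _ _ (trans (rayleigh x Ax≈cx) (sym (+-identityʳ _))))

    Φ≈0⇒eigenvector : (∀ y → (∀ j p → y j p ≈ 0#) → ∀ i → Φᵀ y i ≈ 0#) →
                      ∀ x → (∀ j p → Φ x j p ≈ 0#) → InEigenspace G c x
    Φ≈0⇒eigenvector Φᵀ0≈0 x Φx≈0 i = begin
      apply G x i                    ≈⟨ +-identityʳ _ ⟨
      apply G x i + 0#               ≈⟨ +-congˡ (Φᵀ0≈0 (Φ x) Φx≈0 i) ⟨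
      apply G x i + Φᵀ (Φ x) i       ≈⟨ apply+ΦᵀΦ≈c x i ⟩
      c * x i                        ∎

Reach-trans : ∀ {m} {G : SignedGraph m} {i j k} → Reach G i j → Reach G j k → Reach G i k
Reach-trans r here          = r
Reach-trans r (step r′ j~k) = step (Reach-trans r r′) j~k

Reach-sym : ∀ {m} {G : SignedGraph m} {i j} → Reach G i j → Reach G j i
Reach-sym here                  = here
Reach-sym {G = G} (step r j~k) = Reach-trans (step here (j~k ∘ ≡.trans (symmetric G _ _))) (Reach-sym r)

negativeClique⇒¬Colorable : ∀ {m k} (G : SignedGraph m) (τ : Fin k → Fin m) →
  (∀ i j → i ≢ j → edge G (τ i) (τ j) ≡ neg) → ∀ t → t < k → ¬ Colorable G t
negativeClique⇒¬Colorable G τ clique t t<k (c , c-neg , _)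
  with i , j , i<j , cτi≡cτj ← pigeonhole t<k (c ∘ τ)
  = c-neg (τ i) (τ j) (clique i j (<⇒≢ i<j)) cτi≡cτj

_≟ˡ_ : DecidableEquality Label
none ≟ˡ none = yes ≡.refl
none ≟ˡ pos  = no λ ()
none ≟ˡ neg  = no λ ()
pos  ≟ˡ none = no λ ()
pos  ≟ˡ pos  = yes ≡.refl
pos  ≟ˡ neg  = no λ ()
neg  ≟ˡ none = no λ ()
neg  ≟ˡ pos  = no λ ()
neg  ≟ˡ neg  = yes ≡.refl

Kind : Set
Kind = Fin 6

pattern A = 0F
pattern B = 1F
pattern C = 2F
pattern D = 3F
pattern E = 4F
pattern L = 5F

-- The signed adjacency matrix of one copy, in the order A B C D E L, except that its
-- positive D–L entry joins L of copy p to D of copy p + 1: `shift` says in which copy an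
-- edge between two kinds ends.
sign : Kind → Kind → Label
sign k k′ = lookup (lookup table k) k′
  where
  table : Vec (Vec Label 6) 6
  table = (none ∷ none ∷ neg  ∷ neg  ∷ none ∷ none ∷ [])
        ∷ (none ∷ none ∷ neg  ∷ neg  ∷ none ∷ none ∷ [])
        ∷ (neg  ∷ neg  ∷ none ∷ neg  ∷ neg  ∷ neg  ∷ [])
        ∷ (neg  ∷ neg  ∷ neg  ∷ none ∷ none ∷ pos  ∷ [])
        ∷ (none ∷ none ∷ neg  ∷ none ∷ none ∷ neg  ∷ [])
        ∷ (none ∷ none ∷ neg  ∷ pos  ∷ neg  ∷ none ∷ [])
        ∷ []

shift : Kind → Kind → Shift
shift L D = forward
shift D L = backward
shift _ _ = stay

sign-sym : ∀ k k′ → sign k k′ ≡ sign k′ k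
sign-sym = from-yes (all? λ k → all? λ k′ → sign k k′ ≟ˡ sign k′ k)

sign-diag : ∀ k → sign k k ≡ none
sign-diag = from-yes (all? λ k → sign k k ≟ˡ none)

shift-reverse : ∀ k k′ → shift k′ k ≡ reverse (shift k k′)
shift-reverse = from-yes (all? λ k → all? λ k′ → shift k′ k ≟ˢ reverse (shift k k′))

indicator : Label → ℕ
indicator l = if does (isEdge? l) then 1 else 0

kindDegree : Kind → ℕ
kindDegree k = ℕΣ.sum (λ k′ → indicator (sign k k′))

kindDegree≤5 : ∀ k → kindDegree k ≤ 5
kindDegree≤5 = from-yes (all? λ k → kindDegree k ≤? 5)

colour : Kind → Fin 3
colour = lookup (0F ∷ 0F ∷ 1F ∷ 2F ∷ 0F ∷ 2F ∷ [])

Respects : Label → Fin 3 → Fin 3 → Set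
Respects none _ _  = ⊤
Respects pos  c c′ = c ≡ c′
Respects neg  c c′ = c ≢ c′

respects? : ∀ l c c′ → Dec (Respects l c c′)
respects? none _ _  = yes _
respects? pos  c c′ = c ≟ᶠ c′
respects? neg  c c′ = ¬? (c ≟ᶠ c′)

sign-respects : ∀ k k′ → Respects (sign k k′) (colour k) (colour k′)
sign-respects = from-yes (all? λ k → all? λ k′ → respects? (sign k k′) (colour k) (colour k′))

triangle : Fin 3 → Kind
triangle = lookup (C ∷ E ∷ L ∷ [])

triangle-negative : ∀ i j → i ≢ j → shift (triangle i) (triangle j) ≡ stay × sign (triangle i) (triangle j) ≡ neg
triangle-negative = from-yes (all? λ i → all? λ j →
  ¬? (i ≟ᶠ j) →-dec (shift (triangle i) (triangle j) ≟ˢ stay ×-dec sign (triangle i) (triangle j) ≟ˡ neg))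

module CyclicLift (m : ℕ) where
  open CyclicOrder m public
  open ≡ using (refl; sym; trans; cong; subst)

  n : ℕ
  n = suc m

  vertex : Kind → Fin n → Fin (6 ℕ.* n)
  vertex = combine

  vertex-elim : ∀ {p} (P : Fin (6 ℕ.* n) → Set p) → (∀ k q → P (vertex k q)) → ∀ i → P i
  vertex-elim P P-vertex i = subst P (combine-remQuot n i) (uncurry P-vertex (remQuot n i))

  arc : Kind × Fin n → Kind × Fin n → Label
  arc (k , p) (k′ , q) with q ≟ᶠ move (shift k k′) p
  ... | yes _ = sign k k′
  ... | no _  = none

  arc-target : ∀ k k′ p → arc (k , p) (k′ , move (shift k k′) p) ≡ sign k k′
  arc-target k k′ p with move (shift k k′) p ≟ᶠ move (shift k k′) p
  ... | yes _ = refl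
  ... | no ≢  = contradiction refl ≢

  arc-sameCopy : ∀ k k′ p → shift k k′ ≡ stay → arc (k , p) (k′ , p) ≡ sign k k′
  arc-sameCopy k k′ p stay≡ = subst (λ s → arc (k , p) (k′ , move s p) ≡ sign k k′) stay≡ (arc-target k k′ p)

  arc-elsewhere : ∀ k k′ p q → q ≢ move (shift k k′) p → arc (k , p) (k′ , q) ≡ none
  arc-elsewhere k k′ p q q≢ with q ≟ᶠ move (shift k k′) p
  ... | yes q≡ = contradiction q≡ q≢
  ... | no _   = refl

  move-shift-reverse : ∀ k k′ {p q} → q ≡ move (shift k k′) p → p ≡ move (shift k′ k) q
  move-shift-reverse k k′ {p} {q} q≡ =
    subst (λ s → p ≡ move s q) (sym (shift-reverse k k′)) (move-reverse (shift k k′) q≡)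

  arc-sym : ∀ u w → arc u w ≡ arc w u
  arc-sym (k , p) (k′ , q) with q ≟ᶠ move (shift k k′) p | p ≟ᶠ move (shift k′ k) q
  ... | yes _  | yes _  = sign-sym k k′
  ... | no _   | no _   = refl
  ... | yes q≡ | no p≢  = contradiction (move-shift-reverse k k′ q≡) p≢
  ... | no q≢  | yes p≡ = contradiction (move-shift-reverse k′ k p≡) q≢

  arc-loop : ∀ u → arc u u ≡ none
  arc-loop (k , p) with p ≟ᶠ move (shift k k) p
  ... | yes _ = sign-diag k
  ... | no _  = refl

  G : SignedGraph (6 ℕ.* n)
  G = record
    { edge      = λ i j → arc (remQuot n i) (remQuot n j)
    ; symmetric = λ i j → arc-sym (remQuot n i) (remQuot n j)
    ; loopless  = λ i → arc-loop (remQuot n i)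
    }

  edge-vertex : ∀ k p k′ q → edge G (vertex k p) (vertex k′ q) ≡ arc (k , p) (k′ , q)
  edge-vertex k p k′ q = ≡.cong₂ arc (remQuot-combine k p) (remQuot-combine k′ q)

  degree-vertex : ∀ k p → degree G (vertex k p) ≡ kindDegree k
  degree-vertex k p = begin
    degree G (vertex k p)                           ≡⟨ length-filter-tabulate (isEdge? ∘ edge G (vertex k p)) id ⟩
    ℕΣ.sum f                                        ≡⟨ ℕΣ.sum-combine 6 {n} f ⟩
    ℕΣ.sum (λ k′ → ℕΣ.sum (f ∘ vertex k′))          ≡⟨ ℕΣ.sum-cong-≋ {6} onlyTarget ⟩
    ℕΣ.sum (λ k′ → f (vertex k′ (target k′)))       ≡⟨ ℕΣ.sum-cong-≋ {6} atTarget ⟩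
    kindDegree k                                    ∎
    where
    open ≡.≡-Reasoning
    f : Fin (6 ℕ.* n) → ℕ
    f j = indicator (edge G (vertex k p) j)
    target : Kind → Fin n
    target k′ = move (shift k k′) p
    onlyTarget : ∀ k′ → ℕΣ.sum (f ∘ vertex k′) ≡ f (vertex k′ (target k′))
    onlyTarget k′ = ℕΣ.sum-δ (target k′) (f ∘ vertex k′) λ q q≢ →
      cong indicator (trans (edge-vertex k p k′ q) (arc-elsewhere k k′ p q q≢))
    atTarget : ∀ k′ → f (vertex k′ (target k′)) ≡ indicator (sign k k′)
    atTarget k′ = cong indicator (trans (edge-vertex k p k′ (target k′)) (arc-target k k′ p))

  maxDegree : MaxDegree G 5
  maxDegree = vertex-elim (λ i → degree G i ≤ 5) (λ k p → subst (_≤ 5) (sym (degree-vertex k p)) (kindDegree≤5 k))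
            , vertex C zero , degree-vertex C zero

  arc-respects : ∀ u w → Respects (arc u w) (colour (proj₁ u)) (colour (proj₁ w))
  arc-respects (k , p) (k′ , q) with q ≟ᶠ move (shift k k′) p
  ... | yes _ = sign-respects k k′
  ... | no _  = _

  colouring : Colorable G 3
  colouring = vertexColour , valid neg , valid pos
    where
    vertexColour : Fin (6 ℕ.* n) → Fin 3
    vertexColour = colour ∘ proj₁ ∘ remQuot n
    valid : ∀ l i j → edge G i j ≡ l → Respects l (vertexColour i) (vertexColour j)
    valid l i j e = subst (λ l → Respects l _ _) e (arc-respects (remQuot n i) (remQuot n j))

  negativeTriangle : ∀ i j → i ≢ j → edge G (vertex (triangle i) zero) (vertex (triangle j) zero) ≡ neg
  negativeTriangle i j i≢j = let stay≡ , neg≡ = triangle-negative i j i≢j in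
    trans (edge-vertex (triangle i) zero (triangle j) zero) (trans (arc-sameCopy (triangle i) (triangle j) zero stay≡) neg≡)

  chromaticNumber : ChromaticNumber G 3
  chromaticNumber = colouring , negativeClique⇒¬Colorable G (λ i → vertex (triangle i) zero) negativeTriangle

  adjacent-sameCopy : ∀ k k′ p → shift k k′ ≡ stay → sign k k′ ≢ none → Adj G (vertex k p) (vertex k′ p)
  adjacent-sameCopy k k′ p stay≡ sign≢none =
    sign≢none ∘ trans (sym (arc-sameCopy k k′ p stay≡)) ∘ trans (sym (edge-vertex k p k′ p))

  fromHub : ∀ k p → Reach G (vertex C p) (vertex k p)
  fromHub A p = step here (adjacent-sameCopy C A p refl λ ())
  fromHub B p = step here (adjacent-sameCopy C B p refl λ ())
  fromHub C p = here
  fromHub D p = step here (adjacent-sameCopy C D p refl λ ())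
  fromHub E p = step here (adjacent-sameCopy C E p refl λ ())
  fromHub L p = step here (adjacent-sameCopy C L p refl λ ())

  link : ∀ p → Adj G (vertex L p) (vertex D (next p))
  link p = (λ ()) ∘ trans (sym (arc-target L D p)) ∘ trans (sym (edge-vertex L p D (next p)))

  hub-next : ∀ p → Reach G (vertex C p) (vertex C (next p))
  hub-next p = Reach-trans (step (fromHub L p) (link p)) (Reach-sym (fromHub D (next p)))

  fromHub₀ : ∀ i → Reach G (vertex C zero) i
  fromHub₀ = vertex-elim _ λ k p → Reach-trans (hubs p) (fromHub k p)
    where
    hubs : ∀ p → Reach G (vertex C zero) (vertex C p)
    hubs = <-weakInduction _ here λ p r →
      subst (Reach G (vertex C zero) ∘ vertex C) (next-inject₁ p) (Reach-trans r (hub-next (inject₁ p)))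

  connected : Connected G
  connected i j = Reach-trans (Reach-sym (fromHub₀ i)) (fromHub₀ j)

module Spectrum (ℝ : Reals) (m : ℕ) where
  open Reals ℝ hiding (zero)
  open Spectral ℝ hiding (LargestEigenvalueMultiplicity)
  open OrderedField ℝ
  open LinearAlgebra ℝ
  open CyclicLift m
  open import Relation.Binary.Reasoning.Setoid setoid

  _[_,_] : (Fin (6 ℕ.* n) → Carrier) → Kind → Fin n → Carrier
  x [ k , p ] = x (vertex k p)

  flatten : (Kind → Fin n → Carrier) → Fin (6 ℕ.* n) → Carrier
  flatten X = uncurry X ∘ remQuot n

  flatten-vertex : ∀ X k p → flatten X (vertex k p) ≡ X k p
  flatten-vertex X k p = ≡.cong (uncurry X) (remQuot-combine k p)

  apply-vertex : ∀ x k p → apply G x (vertex k p) ≈ sum (λ k′ → entry (sign k k′) * x [ k′ , move (shift k k′) p ])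
  apply-vertex x k p = begin
    sumᵣ f                                    ≡⟨ sumᵣ≡sum f ⟩
    sum f                                     ≈⟨ sum-combine 6 {n} f ⟩
    sum (λ k′ → sum (f ∘ vertex k′))          ≈⟨ sum-cong-≋ {6} onlyTarget ⟩
    sum (λ k′ → f (vertex k′ (target k′)))    ≈⟨ sum-cong-≋ {6} atTarget ⟩
    sum (λ k′ → entry (sign k k′) * x [ k′ , target k′ ]) ∎
    where
    f : Fin (6 ℕ.* n) → Carrier
    f j = entry (edge G (vertex k p) j) * x j
    target : Kind → Fin n
    target k′ = move (shift k k′) p
    onlyTarget : ∀ k′ → sum (f ∘ vertex k′) ≈ f (vertex k′ (target k′))
    onlyTarget k′ = sum-δ (target k′) (f ∘ vertex k′) λ q q≢ →
      trans (*-congʳ (reflexive (≡.cong entry (≡.trans (edge-vertex k p k′ q) (arc-elsewhere k k′ p q q≢)))))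
            (zeroˡ _)
    atTarget : ∀ k′ → f (vertex k′ (target k′)) ≈ entry (sign k k′) * x [ k′ , target k′ ]
    atTarget k′ = *-congʳ (reflexive (≡.cong entry (≡.trans (edge-vertex k p k′ (target k′)) (arc-target k k′ p))))

  form : (Kind → Fin n → Carrier) → Fin 5 → Fin n → Carrier
  form X 0F p = X A p + X B p + X C p + X D p
  form X 1F p = X A p - X B p
  form X 2F p = X C p + X E p + X L p
  form X 3F p = X D p - X L (prev p)
  form X 4F p = X E p

  formᵀ : (Fin 5 → Fin n → Carrier) → Kind → Fin n → Carrier
  formᵀ y A p = y 0F p + y 1F p
  formᵀ y B p = y 0F p - y 1F p
  formᵀ y C p = y 0F p + y 2F p
  formᵀ y D p = y 0F p + y 3F p
  formᵀ y E p = y 2F p + y 4F p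
  formᵀ y L p = y 2F p - y 3F (next p)

  Φ : (Fin (6 ℕ.* n) → Carrier) → Fin 5 → Fin n → Carrier
  Φ x = form (x [_,_])

  Φᵀ : (Fin 5 → Fin n → Carrier) → Fin (6 ℕ.* n) → Carrier
  Φᵀ y = flatten (formᵀ y)

  rowIdentity : ∀ x k p → sum (λ k′ → entry (sign k k′) * x [ k′ , move (shift k k′) p ]) + formᵀ (Φ x) k p
                          ≈ two * x [ k , p ]
  rowIdentity x A p = solve 6 (λ a b c d e l →
    con 0ℤ :* a :+ (con 0ℤ :* b :+ (con -1ℤ :* c :+ (con -1ℤ :* d :+ (con 0ℤ :* e :+ (con 0ℤ :* l :+ con 0ℤ)))))
      :+ ((a :+ b :+ c :+ d) :+ (a :- b)) := (con 1ℤ :+ con 1ℤ) :* a)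
    refl (x [ A , p ]) (x [ B , p ]) (x [ C , p ]) (x [ D , p ]) (x [ E , p ]) (x [ L , p ])
  rowIdentity x B p = solve 6 (λ a b c d e l →
    con 0ℤ :* a :+ (con 0ℤ :* b :+ (con -1ℤ :* c :+ (con -1ℤ :* d :+ (con 0ℤ :* e :+ (con 0ℤ :* l :+ con 0ℤ)))))
      :+ ((a :+ b :+ c :+ d) :- (a :- b)) := (con 1ℤ :+ con 1ℤ) :* b)
    refl (x [ A , p ]) (x [ B , p ]) (x [ C , p ]) (x [ D , p ]) (x [ E , p ]) (x [ L , p ])
  rowIdentity x C p = solve 6 (λ a b c d e l →
    con -1ℤ :* a :+ (con -1ℤ :* b :+ (con 0ℤ :* c :+ (con -1ℤ :* d :+ (con -1ℤ :* e :+ (con -1ℤ :* l :+ con 0ℤ)))))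
      :+ ((a :+ b :+ c :+ d) :+ (c :+ e :+ l)) := (con 1ℤ :+ con 1ℤ) :* c)
    refl (x [ A , p ]) (x [ B , p ]) (x [ C , p ]) (x [ D , p ]) (x [ E , p ]) (x [ L , p ])
  rowIdentity x D p = solve 6 (λ a b c d e l′ →
    con -1ℤ :* a :+ (con -1ℤ :* b :+ (con -1ℤ :* c :+ (con 0ℤ :* d :+ (con 0ℤ :* e :+ (con 1ℤ :* l′ :+ con 0ℤ)))))
      :+ ((a :+ b :+ c :+ d) :+ (d :- l′)) := (con 1ℤ :+ con 1ℤ) :* d)
    refl (x [ A , p ]) (x [ B , p ]) (x [ C , p ]) (x [ D , p ]) (x [ E , p ]) (x [ L , prev p ])
  rowIdentity x E p = solve 6 (λ a b c d e l →
    con 0ℤ :* a :+ (con 0ℤ :* b :+ (con -1ℤ :* c :+ (con 0ℤ :* d :+ (con 0ℤ :* e :+ (con -1ℤ :* l :+ con 0ℤ)))))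
      :+ ((c :+ e :+ l) :+ e) := (con 1ℤ :+ con 1ℤ) :* e)
    refl (x [ A , p ]) (x [ B , p ]) (x [ C , p ]) (x [ D , p ]) (x [ E , p ]) (x [ L , p ])
  rowIdentity x L p rewrite prev-next p = solve 6 (λ a b c d′ e l →
    con 0ℤ :* a :+ (con 0ℤ :* b :+ (con -1ℤ :* c :+ (con 1ℤ :* d′ :+ (con -1ℤ :* e :+ (con 0ℤ :* l :+ con 0ℤ)))))
      :+ ((c :+ e :+ l) :- (d′ :- l)) := (con 1ℤ :+ con 1ℤ) :* l)
    refl (x [ A , p ]) (x [ B , p ]) (x [ C , p ]) (x [ D , next p ]) (x [ E , p ]) (x [ L , p ])

  apply+ΦᵀΦ≈two : ∀ x i → apply G x i + Φᵀ (Φ x) i ≈ two * x i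
  apply+ΦᵀΦ≈two x = vertex-elim _ λ k p →
    trans (+-cong (apply-vertex x k p) (reflexive (flatten-vertex (formᵀ (Φ x)) k p))) (rowIdentity x k p)

  adjoint : ∀ x y → ⟪ Φ x , y ⟫ ≈ ⟨ x , Φᵀ y ⟩
  adjoint x y = +-cancelʳ (sum g) _ _ (begin
    ⟪ Φ x , y ⟫ + sum g                                   ≈⟨ +-congʳ (∑-comm lhs) ⟩
    sum (λ p → sum (λ j → lhs j p)) + sum g               ≈⟨ ∑-distrib-+ {n} (λ p → sum (λ j → lhs j p)) g ⟨
    sum (λ p → sum (λ j → lhs j p) + g p)                 ≈⟨ sum-cong-≋ {n} pointwise ⟩
    sum (λ p → sum (λ k → rhs k p) + g (next p))          ≈⟨ ∑-distrib-+ {n} (λ p → sum (λ k → rhs k p)) (g ∘ next) ⟩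
    sum (λ p → sum (λ k → rhs k p)) + sum (g ∘ next)      ≈⟨ +-cong (sym (∑-comm rhs)) (sum-rotate m g) ⟩
    sum (λ k → sum (λ p → rhs k p)) + sum g               ≈⟨ +-congʳ (sum-cong-≋ {6} flattened) ⟨
    sum (λ k → sum (λ p → x [ k , p ] * Φᵀ y (vertex k p))) + sum g
                                                          ≈⟨ +-congʳ (sum-combine 6 {n} (λ i → x i * Φᵀ y i)) ⟨
    ⟨ x , Φᵀ y ⟩ + sum g                                  ∎)
    where
    lhs : Fin 5 → Fin n → Carrier
    lhs j p = Φ x j p * y j p
    rhs : Kind → Fin n → Carrier
    rhs k p = x [ k , p ] * formᵀ y k p
    g : Fin n → Carrier
    g p = x [ L , prev p ] * y 3F p
    flattenedAt : ∀ k p → x [ k , p ] * Φᵀ y (vertex k p) ≈ rhs k p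
    flattenedAt k p = *-congˡ (reflexive (flatten-vertex (formᵀ y) k p))
    flattened : ∀ k → sum (λ p → x [ k , p ] * Φᵀ y (vertex k p)) ≈ sum (λ p → rhs k p)
    flattened k = sum-cong-≋ {n} (flattenedAt k)
    -- φ₃ is the only form involving two copies; its cross terms g cancel after rotating the sum.
    pointwise : ∀ p → sum (λ j → lhs j p) + g p ≈ sum (λ k → rhs k p) + g (next p)
    pointwise p rewrite prev-next p = solve 13 (λ a b c d e l l′ y₀ y₁ y₂ y₃ y₄ y₃′ →
      (a :+ b :+ c :+ d) :* y₀ :+ ((a :- b) :* y₁ :+ ((c :+ e :+ l) :* y₂ :+ ((d :- l′) :* y₃ :+ (e :* y₄ :+ con 0ℤ))))
        :+ l′ :* y₃
      := a :* (y₀ :+ y₁) :+ (b :* (y₀ :- y₁) :+ (c :* (y₀ :+ y₂) :+ (d :* (y₀ :+ y₃) :+ (e :* (y₂ :+ y₄)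
           :+ (l :* (y₂ :- y₃′) :+ con 0ℤ)))))
        :+ l :* y₃′)
      refl (x [ A , p ]) (x [ B , p ]) (x [ C , p ]) (x [ D , p ]) (x [ E , p ]) (x [ L , p ]) (x [ L , prev p ])
           (y 0F p) (y 1F p) (y 2F p) (y 3F p) (y 4F p) (y 3F (next p))

  form-cong : ∀ {X Y} → (∀ k p → X k p ≈ Y k p) → ∀ j p → form X j p ≈ form Y j p
  form-cong X≈Y 0F p = +-cong (+-cong (+-cong (X≈Y A p) (X≈Y B p)) (X≈Y C p)) (X≈Y D p)
  form-cong X≈Y 1F p = +-cong (X≈Y A p) (-‿cong (X≈Y B p))
  form-cong X≈Y 2F p = +-cong (+-cong (X≈Y C p) (X≈Y E p)) (X≈Y L p)
  form-cong X≈Y 3F p = +-cong (X≈Y D p) (-‿cong (X≈Y L (prev p)))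
  form-cong X≈Y 4F p = X≈Y E p

  formᵀ-≈0 : ∀ {y} → (∀ j p → y j p ≈ 0#) → ∀ k p → formᵀ y k p ≈ 0#
  formᵀ-≈0 y≈0 A p = 0+0≈0 (y≈0 0F p) (y≈0 1F p)
  formᵀ-≈0 y≈0 B p = 0-0≈0 (y≈0 0F p) (y≈0 1F p)
  formᵀ-≈0 y≈0 C p = 0+0≈0 (y≈0 0F p) (y≈0 2F p)
  formᵀ-≈0 y≈0 D p = 0+0≈0 (y≈0 0F p) (y≈0 3F p)
  formᵀ-≈0 y≈0 E p = 0+0≈0 (y≈0 2F p) (y≈0 4F p)
  formᵀ-≈0 y≈0 L p = 0-0≈0 (y≈0 2F p) (y≈0 3F (next p))

  -- Solving φ = 0 for the other kinds: A = B = (L − L of copy p − 1) / 2, C = − L,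
  -- D = L of copy p − 1, E = 0.
  α β : Kind → Carrier
  α A = half
  α B = half
  α C = - 1#
  α D = 0#
  α E = 0#
  α L = 1#
  β A = - half
  β B = - half
  β C = 0#
  β D = 1#
  β E = 0#
  β L = 0#

  extension : (Fin n → Carrier) → Kind → Fin n → Carrier
  extension v k p = α k * v p + β k * v (prev p)

  form-extension : ∀ v j p → form (extension v) j p ≈ 0#
  form-extension v 0F p = begin
    form (extension v) 0F p                          ≈⟨ solve 3 (λ h a a′ →
      (h :* a :+ :- h :* a′) :+ (h :* a :+ :- h :* a′) :+ (:- con 1ℤ :* a :+ con 0ℤ :* a′) :+ (con 0ℤ :* a :+ con 1ℤ :* a′)
      := ((con 1ℤ :+ con 1ℤ) :* h :- con 1ℤ) :* (a :- a′)) refl half (v p) (v (prev p)) ⟩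
    (two * half - 1#) * (v p - v (prev p))           ≈⟨ *-congʳ (trans (+-congʳ two*half≈1) (-‿inverseʳ 1#)) ⟩
    0# * (v p - v (prev p))                          ≈⟨ zeroˡ _ ⟩
    0#                                               ∎
  form-extension v 1F p = solve 3 (λ h a a′ → (h :* a :+ :- h :* a′) :- (h :* a :+ :- h :* a′) := con 0ℤ)
    refl half (v p) (v (prev p))
  form-extension v 2F p = solve 2 (λ a a′ →
    (:- con 1ℤ :* a :+ con 0ℤ :* a′) :+ (con 0ℤ :* a :+ con 0ℤ :* a′) :+ (con 1ℤ :* a :+ con 0ℤ :* a′) := con 0ℤ)
    refl (v p) (v (prev p))
  form-extension v 3F p = solve 3 (λ a a′ a″ →
    (con 0ℤ :* a :+ con 1ℤ :* a′) :- (con 1ℤ :* a′ :+ con 0ℤ :* a″) := con 0ℤ)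
    refl (v p) (v (prev p)) (v (prev (prev p)))
  form-extension v 4F p = solve 2 (λ a a′ → con 0ℤ :* a :+ con 0ℤ :* a′ := con 0ℤ) refl (v p) (v (prev p))

  kernel⇒extension : ∀ X → (∀ j p → form X j p ≈ 0#) → ∀ k p → X k p ≈ extension (X L) k p
  kernel⇒extension X φ≈0 A p = ≈+≈0⇒≈ (trans (x≈x*[two*half] (X A p)) (solve 8 (λ a b c d e l l′ h →
    a :* ((con 1ℤ :+ con 1ℤ) :* h)
      := (h :* l :+ :- h :* l′) :+ h :* ((a :+ b :+ c :+ d) :+ (a :- b) :- (c :+ e :+ l) :+ e :- (d :- l′)))
    refl (X A p) (X B p) (X C p) (X D p) (X E p) (X L p) (X L (prev p)) half))
    (trans (*-congˡ (0-0≈0 (0+0≈0 (0-0≈0 (0+0≈0 (φ≈0 0F p) (φ≈0 1F p)) (φ≈0 2F p)) (φ≈0 4F p)) (φ≈0 3F p)))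
           (zeroʳ half))
  kernel⇒extension X φ≈0 B p = ≈+≈0⇒≈ (trans (x≈x*[two*half] (X B p)) (solve 8 (λ a b c d e l l′ h →
    b :* ((con 1ℤ :+ con 1ℤ) :* h)
      := (h :* l :+ :- h :* l′) :+ h :* ((a :+ b :+ c :+ d) :- (a :- b) :- (c :+ e :+ l) :+ e :- (d :- l′)))
    refl (X A p) (X B p) (X C p) (X D p) (X E p) (X L p) (X L (prev p)) half))
    (trans (*-congˡ (0-0≈0 (0+0≈0 (0-0≈0 (0-0≈0 (φ≈0 0F p) (φ≈0 1F p)) (φ≈0 2F p)) (φ≈0 4F p)) (φ≈0 3F p)))
           (zeroʳ half))
  kernel⇒extension X φ≈0 C p = ≈+≈0⇒≈ (solve 4 (λ c e l l′ →
    c := (:- con 1ℤ :* l :+ con 0ℤ :* l′) :+ ((c :+ e :+ l) :- e)) refl (X C p) (X E p) (X L p) (X L (prev p)))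
    (0-0≈0 (φ≈0 2F p) (φ≈0 4F p))
  kernel⇒extension X φ≈0 D p = ≈+≈0⇒≈ (solve 3 (λ d l l′ →
    d := (con 0ℤ :* l :+ con 1ℤ :* l′) :+ (d :- l′)) refl (X D p) (X L p) (X L (prev p)))
    (φ≈0 3F p)
  kernel⇒extension X φ≈0 E p = ≈+≈0⇒≈ (solve 3 (λ e l l′ →
    e := (con 0ℤ :* l :+ con 0ℤ :* l′) :+ e) refl (X E p) (X L p) (X L (prev p)))
    (φ≈0 4F p)
  kernel⇒extension X φ≈0 L p = solve 2 (λ l l′ → l := con 1ℤ :* l :+ con 0ℤ :* l′) refl (X L p) (X L (prev p))

  extension-combination : ∀ {r} (c : Fin r → Carrier) (M : Fin r → Fin n → Carrier) k p →
    sum (λ l → c l * extension (M l) k p) ≈ extension (λ q → sum (λ l → c l * M l q)) k p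
  extension-combination {r} c M k p = begin
    sum (λ l → c l * extension (M l) k p)                           ≈⟨ sum-cong-≋ {r} distribute ⟩
    sum (λ l → α k * (c l * M l p) + β k * (c l * M l (prev p)))    ≈⟨ ∑-distrib-+ {r} (λ l → α k * (c l * M l p)) _ ⟩
    sum (λ l → α k * (c l * M l p)) + sum (λ l → β k * (c l * M l (prev p)))
      ≈⟨ +-cong (*-distribˡ-sum {r} (α k) _) (*-distribˡ-sum {r} (β k) _) ⟨
    extension (λ q → sum (λ l → c l * M l q)) k p                   ∎
    where
    distribute : ∀ l → c l * extension (M l) k p ≈ α k * (c l * M l p) + β k * (c l * M l (prev p))
    distribute l = solve 5 (λ c α β a a′ → c :* (α :* a :+ β :* a′) := α :* (c :* a) :+ β :* (c :* a′))
      refl (c l) (α k) (β k) (M l p) (M l (prev p))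

  extension-≈0 : ∀ {v} → (∀ q → v q ≈ 0#) → ∀ k p → extension v k p ≈ 0#
  extension-≈0 v≈0 k p = 0+0≈0 (trans (*-congˡ (v≈0 p)) (zeroʳ _)) (trans (*-congˡ (v≈0 (prev p))) (zeroʳ _))

  open SquaresDecomposition G two Φ Φᵀ adjoint apply+ΦᵀΦ≈two

  Φᵀ0≈0 : ∀ y → (∀ j p → y j p ≈ 0#) → ∀ i → Φᵀ y i ≈ 0#
  Φᵀ0≈0 y y≈0 = vertex-elim _ λ k p → trans (reflexive (flatten-vertex (formᵀ y) k p)) (formᵀ-≈0 y≈0 k p)

  δ : Fin n → Fin n → Carrier
  δ q p with q ≟ᶠ p
  ... | yes _ = 1#
  ... | no _  = 0#

  δ-diag : ∀ p → δ p p ≈ 1#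
  δ-diag p with p ≟ᶠ p
  ... | yes _  = refl
  ... | no p≢p = contradiction ≡.refl p≢p

  δ-off : ∀ {q p} → q ≢ p → δ q p ≈ 0#
  δ-off {q} {p} q≢p with q ≟ᶠ p
  ... | yes q≡p = contradiction q≡p q≢p
  ... | no _    = refl

  basis : Fin n → Fin (6 ℕ.* n) → Carrier
  basis q = flatten (extension (δ q))

  basis-eigenvector : ∀ q → InEigenspace G two (basis q)
  basis-eigenvector q = Φ≈0⇒eigenvector Φᵀ0≈0 (basis q) λ j p →
    trans (form-cong (λ k p → reflexive (flatten-vertex (extension (δ q)) k p)) j p) (form-extension (δ q) j p)

  basis-L : ∀ q p → basis q [ L , p ] ≈ δ q p
  basis-L q p = trans (reflexive (flatten-vertex (extension (δ q)) L p))
    (solve 2 (λ a a′ → con 1ℤ :* a :+ con 0ℤ :* a′ := a) refl (δ q p) (δ q (prev p)))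

  basis-independent : LinearlyIndependent basis
  basis-independent c Σcb≈0 p = begin
    c p                                   ≈⟨ *-identityʳ _ ⟨
    c p * 1#                              ≈⟨ *-congˡ (δ-diag p) ⟨
    c p * δ p p                           ≈⟨ sum-δ p (λ q → c q * δ q p) off-diagonal ⟨
    sum (λ q → c q * δ q p)               ≈⟨ sum-cong-≋ {n} (λ q → *-congˡ {c q} (basis-L q p)) ⟨
    sum (λ q → c q * basis q [ L , p ])   ≡⟨ sumᵣ≡sum (λ q → c q * basis q [ L , p ]) ⟨
    sumᵣ (λ q → c q * basis q [ L , p ])  ≈⟨ Σcb≈0 (vertex L p) ⟩
    0#                                    ∎
    where
    off-diagonal : ∀ q → q ≢ p → c q * δ q p ≈ 0#
    off-diagonal q q≢p = trans (*-congˡ (δ-off q≢p)) (zeroʳ (c q))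

  eigenvectors-dependent : ∀ (v : Fin (suc n) → Fin (6 ℕ.* n) → Carrier) →
                           (∀ l → InEigenspace G two (v l)) → ¬ LinearlyIndependent v
  eigenvectors-dependent v eig li = ¬¬-∀ (λ l → eigenvector⇒¬¬Φ≈0 (v l) (eig l)) λ Φv≈0 →
    ¬LinearlyIndependent-suc n M (restriction-independent Φv≈0)
    where
    M : Fin (suc n) → Fin n → Carrier
    M l q = v l [ L , q ]
    restriction-independent : (∀ l j p → Φ (v l) j p ≈ 0#) → LinearlyIndependent M
    restriction-independent Φv≈0 c ΣcM≈0 = li c (vertex-elim _ λ k p → begin
      sumᵣ (λ l → c l * v l [ k , p ])                ≡⟨ sumᵣ≡sum (λ l → c l * v l [ k , p ]) ⟩
      sum (λ l → c l * v l [ k , p ])                 ≈⟨ sum-cong-≋ {suc n} (onKernel k p) ⟩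
      sum (λ l → c l * extension (M l) k p)           ≈⟨ extension-combination c M k p ⟩
      extension (λ q → sum (λ l → c l * M l q)) k p   ≈⟨ extension-≈0 ΣcM≈0′ k p ⟩
      0#                                              ∎)
      where
      onKernel : ∀ k p l → c l * v l [ k , p ] ≈ c l * extension (M l) k p
      onKernel k p l = *-congˡ (kernel⇒extension (v l [_,_]) (Φv≈0 l) k p)
      ΣcM≈0′ : ∀ q → sum (λ l → c l * M l q) ≈ 0#
      ΣcM≈0′ q = trans (reflexive (≡.sym (sumᵣ≡sum (λ l → c l * M l q)))) (ΣcM≈0 q)

  largestEigenvalue : LargestEigenvalueMultiplicity ℝ G n
  largestEigenvalue = two , (basis zero , (vertex L zero , basis≉0) , basis-eigenvector zero)
                    , eigenvalue≤ , (basis , basis-eigenvector , basis-independent) , eigenvectors-dependent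
    where
    basis≉0 : ¬ basis zero [ L , zero ] ≈ 0#
    basis≉0 b≈0 = 0≉1 (trans (sym b≈0) (trans (basis-L zero zero) (δ-diag zero)))

open import Data.Nat using (_*_)

-- The construction works for every n ≥ 1; the hypothesis 3 ≤ n only exhibits n as a successor.
theorem1p15 : (n : ℕ) → 3 ≤ n →
    Σ (SignedGraph (6 * n)) (λ G →
      Connected G × MaxDegree G 5 × ChromaticNumber G 3 ×
      ((ℝ : Reals) → LargestEigenvalueMultiplicity ℝ G n))
theorem1p15 (suc m) _ = G , connected , maxDegree , chromaticNumber , λ ℝ → Spectrum.largestEigenvalue ℝ m
  where open CyclicLift m
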